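{- Let $j\ge 2$ and $n\ge j+1$ be integers. Then: (1) for every integer $k$ with $j+1\le k\le j+2$ and $k\le n$, $f_j(k)=\binom{k}{2}$; (2) for every integer $k$ with $j+3\le k\le n$, \[ f_j(k)\le 1+\max_{\substack{j+1\le k_1,k_2\le k-1\\ k_1+k_2=k+j}}\bigl(f_j(k_1)+f_j(k_2)\bigr). \]
   Context: Let $j\ge 2$. For a graph $G$ with at least $j+1$ vertices, the $j$-erase procedure deletes an edge $e\in E(G)$ provided there exist two disjoint sets $V^1,V^2\subset V(G)$ such that $e$ is the only edge of $G$ between $V^1$ and $V^2$ and $|V(G)|-|V^1|-|V^2|=j$; by convention, the $j$-erase procedure may also be applied to any edge of any graph on $j+1$ vertices. A graph is $j$-erasable if the $j$-erase procedure can be applied repeatedly until the graph has no edges. For $j+1\le k\le n$, $f_j(k)$ denotes the maximum number of edges of a $j$-erasable graph on $n$ vertices with $n-k$ isolated vertices. -}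

module Defs where

open import Data.Nat using (ℕ; zero; suc; _+_; _∸_; _≤_; _<ᵇ_)
open import Data.Bool using (Bool; true; false; _∧_; _∨_; if_then_else_; not)
open import Data.Fin using (Fin; toℕ; _≟_)
open import Data.Fin.Subset using (Subset; _∈_; _∉_; ∣_∣)
open import Data.List using (List; allFin; cartesianProductWith; map)
open import Data.Nat.ListAction using (sum)
open import Data.Bool.ListAction using (any)
open import Data.Product using (Σ; _×_; _,_)
open import Data.Sum using (_⊎_)
open import Relation.Binary.PropositionalEquality using (_≡_)
open import Relation.Nullary.Decidable using (⌊_⌋)

Graph : ℕ → Set
Graph n = Fin n → Fin n → Bool

IsSimple : ∀ {n} → Graph n → Set
IsSimple {n} G = (∀ a b → G a b ≡ G b a) × (∀ a → G a a ≡ false)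

edgeCount : ∀ {n} → Graph n → ℕ
edgeCount {n} G =
  sum (cartesianProductWith (λ a b → if (toℕ a <ᵇ toℕ b) ∧ G a b then 1 else 0) (allFin n) (allFin n))

isIsolatedᵇ : ∀ {n} → Graph n → Fin n → Bool
isIsolatedᵇ {n} G v = not (any (G v) (allFin n))

isolatedCount : ∀ {n} → Graph n → ℕ
isolatedCount {n} G = sum (map (λ v → if isIsolatedᵇ G v then 1 else 0) (allFin n))

deleteEdge : ∀ {n} → Graph n → Fin n → Fin n → Graph n
deleteEdge G u v a b =
  if (⌊ a ≟ u ⌋ ∧ ⌊ b ≟ v ⌋) ∨ (⌊ a ≟ v ⌋ ∧ ⌊ b ≟ u ⌋) then false else G a b

JEraseAllowed : ∀ {n} → ℕ → Graph n → Fin n → Fin n → Set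
JEraseAllowed {n} j G u v =
  (n ≡ suc j) ⊎
  Σ (Subset n) λ V₁ → Σ (Subset n) λ V₂ →
    (∀ x → x ∈ V₁ → x ∉ V₂) ×
    (∣ V₁ ∣ + ∣ V₂ ∣ + j ≡ n) ×
    ((u ∈ V₁ × v ∈ V₂) ⊎ (v ∈ V₁ × u ∈ V₂)) ×
    (∀ a b → a ∈ V₁ → b ∈ V₂ → G a b ≡ true →
       (a ≡ u × b ≡ v) ⊎ (a ≡ v × b ≡ u))

data JErasable {n : ℕ} (j : ℕ) : Graph n → Set where
  done : ∀ {G} → (∀ a b → G a b ≡ false) → JErasable j G
  step : ∀ {G} (u v : Fin n) → G u v ≡ true → JErasable j (deleteEdge G u v)
         → JEraseAllowed j G u v → JErasable j G

Admissible : (n j k : ℕ) → Graph n → Set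
Admissible n j k G = IsSimple G × JErasable j G × (isolatedCount G ≡ n ∸ k)

-- "f_j(k) = m" (for graphs on n vertices): m is the maximum edge count
IsFj : (n j k m : ℕ) → Set
IsFj n j k m =
  (Σ (Graph n) λ G → Admissible n j k G × edgeCount G ≡ m) ×
  (∀ (G : Graph n) → Admissible n j k G → edgeCount G ≤ m)

{-# OPTIONS --safe #-}

-- For k ≤ j + 2 the clique on k vertices is extremal: a graph with k non-isolated vertices has
-- at most C(k,2) edges, and the clique is j-erasable because any edge uv of a subgraph is cut off
-- by V₁ = {u} and V₂ = {v} ∪ (the complement of a (j + 2)-set containing the clique).
--
-- For k ≥ j + 3 take an extremal graph G and the first edge uv it erases, with witnesses V₁, V₂.
-- The subgraphs G₁, G₂ induced on the complements of V₁ and V₂ avoid uv, so they lie in G − uv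
-- and are j-erasable, and every other edge of G lies in one of them: e(G) ≤ e(G₁) + e(G₂) + 1.
-- Their numbers m₁, m₂ of non-isolated vertices are below k (each misses an endpoint of uv), and
-- m₁ + m₂ ≤ k + j because G₁ and G₂ share only the j vertices outside V₁ ∪ V₂. A j-erasable graph
-- with at most t non-isolated vertices has at most f_j(t) edges: attach pendant edges xw
-- (x isolated, erased first with V₁ = {x}) until exactly t vertices are non-isolated. Hence
-- f_j(k) ≤ 1 + f_j(k₁) + f_j(k₂) for k₁ = max (j + 1) m₁ and k₂ = k + j − k₁.

module Submission where

open import Defs
open import Data.Nat using (ℕ; zero; suc; _+_; _∸_; _≤_; _<_; _<ᵇ_; _⊔_; z≤n; s≤s; s≤s⁻¹; z<s)
open import Data.Nat.Properties renaming (_≟_ to _≟ℕ_)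
open import Data.Nat.Combinatorics using (_C_; nCk+nC[k+1]≡[n+1]C[k+1]; nC1≡n)
open import Data.Nat.ListAction using () renaming (sum to listSum)
open import Data.Nat.ListAction.Properties using (sum-++)
open import Data.Bool using (Bool; true; false; _∧_; _∨_; not; if_then_else_)
open import Data.Bool.Properties
  using (∧-comm; ∨-comm; ∧-identityʳ; ∧-zeroʳ; ∨-identityʳ; ∨-zeroʳ; ¬-not; T-≡)
open import Data.Bool.ListAction using (any)
open import Data.Fin as Fin using (Fin; toℕ; _≟_)
open import Data.Fin.Subset
open import Data.Fin.Subset.Properties
open import Data.List using (List; []; _∷_; map; allFin; cartesianProductWith; cartesianProduct)
open import Data.List.Relation.Unary.Any using (here; there)
import Data.List.Membership.Propositional as List
open import Data.List.Membership.Propositional.Properties using (∈-allFin; ∈-cartesianProduct⁺)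
import Data.List as List
open import Data.List.Properties using (map-tabulate)
open import Data.List.Relation.Unary.Any.Properties using (any⁺; any⁻; tabulate⁺; tabulate⁻)
open import Data.Vec using ([]; _∷_; lookup; tabulate; here; there)
open import Data.Vec.Properties using (lookup∘tabulate; tabulate-∘; []=⇒lookup; lookup⇒[]=)
open import Data.Product using (Σ; ∃; _×_; _,_; proj₁; proj₂)
open import Data.Sum using (_⊎_; inj₁; inj₂; [_,_])
open import Function using (id; _∘_; case_of_; Equivalence)
open import Relation.Binary.PropositionalEquality
  using (_≡_; _≢_; refl; sym; trans; cong; cong₂; subst; subst₂; module ≡-Reasoning)
open import Relation.Nullary using (¬_; yes; no; does; contradiction)
open import Relation.Nullary.Decidable using (⌊_⌋)
open import Algebra.Properties.CommutativeMonoid.Sum +-0-commutativeMonoid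
  using (sum; sum-syntax; sum-cong-≗; ∑-distrib-+; sum-replicate-zero)

private
  variable
    n j : ℕ
    G H : Graph n
    u v a b : Fin n

𝟙 : Bool → ℕ
𝟙 b = if b then 1 else 0

𝟙-mono : ∀ {x y} → (x ≡ true → y ≡ true) → 𝟙 x ≤ 𝟙 y
𝟙-mono {false} _   = z≤n
𝟙-mono {true}  x⇒y rewrite x⇒y refl = ≤-refl

sum-mono : ∀ {f g : Fin n → ℕ} → (∀ i → f i ≤ g i) → sum f ≤ sum g
sum-mono {zero}  f≤g = z≤n
sum-mono {suc n} f≤g = +-mono-≤ (f≤g Fin.zero) (sum-mono (f≤g ∘ Fin.suc))

sum-mono-+ : ∀ {f g h : Fin n → ℕ} → (∀ i → f i ≤ g i + h i) → sum f ≤ sum g + sum h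
sum-mono-+ {g = g} {h} f≤g+h = ≤-trans (sum-mono f≤g+h) (≤-reflexive (∑-distrib-+ g h))

sum-tabulate : ∀ (f : Fin n → ℕ) → listSum (List.tabulate f) ≡ sum f
sum-tabulate {zero}  f = refl
sum-tabulate {suc n} f = cong (f Fin.zero +_) (sum-tabulate (f ∘ Fin.suc))

sum-map-allFin : ∀ (f : Fin n → ℕ) → listSum (map f (allFin n)) ≡ sum f
sum-map-allFin f = trans (cong listSum (map-tabulate id f)) (sum-tabulate f)

sum-cartesianProductWith : ∀ {A B : Set} (f : A → B → ℕ) xs ys →
  listSum (cartesianProductWith f xs ys) ≡ listSum (map (λ x → listSum (map (f x) ys)) xs)
sum-cartesianProductWith f []       ys = refl
sum-cartesianProductWith f (x ∷ xs) ys =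
  trans (sum-++ (map (f x) ys) _) (cong (listSum (map (f x) ys) +_) (sum-cartesianProductWith f xs ys))

∣p∣≡∑ : ∀ (p : Subset n) → ∣ p ∣ ≡ ∑[ i < n ] 𝟙 (lookup p i)
∣p∣≡∑ []            = refl
∣p∣≡∑ (inside  ∷ p) = cong suc (∣p∣≡∑ p)
∣p∣≡∑ (outside ∷ p) = ∣p∣≡∑ p

∣tabulate∣≡∑ : ∀ (b : Fin n → Bool) → ∣ tabulate b ∣ ≡ ∑[ i < n ] 𝟙 (b i)
∣tabulate∣≡∑ b = trans (∣p∣≡∑ (tabulate b)) (sum-cong-≗ (cong 𝟙 ∘ lookup∘tabulate b))

∈-tabulate⁺ : ∀ {f : Fin n → Bool} {a} → f a ≡ true → a ∈ tabulate f
∈-tabulate⁺ {f = f} {a} fa = lookup⇒[]= a _ (trans (lookup∘tabulate f a) fa)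

∈-tabulate⁻ : ∀ {f : Fin n → Bool} {a} → a ∈ tabulate f → f a ≡ true
∈-tabulate⁻ {f = f} {a} a∈ = trans (sym (lookup∘tabulate f a)) ([]=⇒lookup a∈)

∣Empty∣≡0 : ∀ {p : Subset n} → Empty p → ∣ p ∣ ≡ 0
∣Empty∣≡0 {n} p-empty = trans (cong ∣_∣ (Empty-unique p-empty)) (∣⊥∣≡0 n)

0<∣p∣⇒Nonempty : ∀ {p : Subset n} → 0 < ∣ p ∣ → Nonempty p
0<∣p∣⇒Nonempty {p = p} 0<∣p∣ with nonempty? p
... | yes p-nonempty = p-nonempty
... | no  p-empty    = contradiction (∣Empty∣≡0 p-empty) (>⇒≢ 0<∣p∣)

∣p∪q∣+∣p∩q∣≡∣p∣+∣q∣ : ∀ (p q : Subset n) → ∣ p ∪ q ∣ + ∣ p ∩ q ∣ ≡ ∣ p ∣ + ∣ q ∣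
∣p∪q∣+∣p∩q∣≡∣p∣+∣q∣ []            []            = refl
∣p∪q∣+∣p∩q∣≡∣p∣+∣q∣ (inside  ∷ p) (inside  ∷ q) =
  cong suc (trans (+-suc _ _) (trans (cong suc (∣p∪q∣+∣p∩q∣≡∣p∣+∣q∣ p q)) (sym (+-suc _ _))))
∣p∪q∣+∣p∩q∣≡∣p∣+∣q∣ (inside  ∷ p) (outside ∷ q) = cong suc (∣p∪q∣+∣p∩q∣≡∣p∣+∣q∣ p q)
∣p∪q∣+∣p∩q∣≡∣p∣+∣q∣ (outside ∷ p) (inside  ∷ q) =
  trans (cong suc (∣p∪q∣+∣p∩q∣≡∣p∣+∣q∣ p q)) (sym (+-suc _ _))
∣p∪q∣+∣p∩q∣≡∣p∣+∣q∣ (outside ∷ p) (outside ∷ q) = ∣p∪q∣+∣p∩q∣≡∣p∣+∣q∣ p q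

∣p∪q∣≤∣p∣+∣q∣ : ∀ (p q : Subset n) → ∣ p ∪ q ∣ ≤ ∣ p ∣ + ∣ q ∣
∣p∪q∣≤∣p∣+∣q∣ p q = subst (∣ p ∪ q ∣ ≤_) (∣p∪q∣+∣p∩q∣≡∣p∣+∣q∣ p q) (m≤m+n _ _)

∣p∪q∣≡∣p∣+∣q∣ : ∀ (p q : Subset n) → Empty (p ∩ q) → ∣ p ∪ q ∣ ≡ ∣ p ∣ + ∣ q ∣
∣p∪q∣≡∣p∣+∣q∣ p q disjoint = begin
  ∣ p ∪ q ∣                ≡⟨ +-identityʳ _ ⟨
  ∣ p ∪ q ∣ + 0            ≡⟨ cong (∣ p ∪ q ∣ +_) (∣Empty∣≡0 disjoint) ⟨
  ∣ p ∪ q ∣ + ∣ p ∩ q ∣    ≡⟨ ∣p∪q∣+∣p∩q∣≡∣p∣+∣q∣ p q ⟩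
  ∣ p ∣ + ∣ q ∣            ∎
  where open ≡-Reasoning

∣⁅x⁆∪p∣≡1+∣p∣ : ∀ {x : Fin n} {p} → x ∉ p → ∣ ⁅ x ⁆ ∪ p ∣ ≡ suc ∣ p ∣
∣⁅x⁆∪p∣≡1+∣p∣ {x = x} {p} x∉p =
  trans (∣p∪q∣≡∣p∣+∣q∣ ⁅ x ⁆ p disjoint) (cong (_+ ∣ p ∣) (∣⁅x⁆∣≡1 x))
  where
  disjoint : Empty (⁅ x ⁆ ∩ p)
  disjoint (y , y∈⁅x⁆∩p) with x∈p∩q⁻ ⁅ x ⁆ p y∈⁅x⁆∩p
  ... | y∈⁅x⁆ , y∈p rewrite x∈⁅y⁆⇒x≡y x y∈⁅x⁆ = x∉p y∈p

∣∁[p∪q]∣≡j : ∀ {n j} {p q : Subset n} → (∀ x → x ∈ p → x ∉ q) → ∣ p ∣ + ∣ q ∣ + j ≡ n →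
  ∣ ∁ (p ∪ q) ∣ ≡ j
∣∁[p∪q]∣≡j {n} {j} {p} {q} disjoint size = begin
  ∣ ∁ (p ∪ q) ∣                        ≡⟨ ∣∁p∣≡n∸∣p∣ (p ∪ q) ⟩
  n ∸ ∣ p ∪ q ∣                        ≡⟨ cong₂ _∸_ (sym size) (∣p∪q∣≡∣p∣+∣q∣ p q p∩q-empty) ⟩
  ∣ p ∣ + ∣ q ∣ + j ∸ (∣ p ∣ + ∣ q ∣)  ≡⟨ m+n∸m≡n (∣ p ∣ + ∣ q ∣) j ⟩
  j                                    ∎
  where
  open ≡-Reasoning
  p∩q-empty : Empty (p ∩ q)
  p∩q-empty (x , x∈p∩q) with x∈p , x∈q ← x∈p∩q⁻ p q x∈p∩q = disjoint x x∈p x∈q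

x∈q⇒x∉p─q : ∀ (p : Subset n) {q x} → x ∈ q → x ∉ p ─ q
x∈q⇒x∉p─q (_ ∷ p) {inside ∷ q} here        ()
x∈q⇒x∉p─q (_ ∷ p) {_      ∷ q} (there x∈q) (there x∈p─q) = x∈q⇒x∉p─q p x∈q x∈p─q

∣p∣≤1+∣p-x∣ : ∀ (p : Subset n) x → ∣ p ∣ ≤ suc ∣ p - x ∣
∣p∣≤1+∣p-x∣ p x = begin
  ∣ p ∣                   ≤⟨ p⊆q⇒∣p∣≤∣q∣ p⊆[p-x]∪⁅x⁆ ⟩
  ∣ (p - x) ∪ ⁅ x ⁆ ∣     ≤⟨ ∣p∪q∣≤∣p∣+∣q∣ (p - x) ⁅ x ⁆ ⟩
  ∣ p - x ∣ + ∣ ⁅ x ⁆ ∣   ≡⟨ cong (∣ p - x ∣ +_) (∣⁅x⁆∣≡1 x) ⟩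
  ∣ p - x ∣ + 1           ≡⟨ +-comm _ 1 ⟩
  suc ∣ p - x ∣           ∎
  where
  open ≤-Reasoning
  p⊆[p-x]∪⁅x⁆ : p ⊆ (p - x) ∪ ⁅ x ⁆
  p⊆[p-x]∪⁅x⁆ {y} y∈p with y ≟ x
  ... | yes refl = x∈p∪q⁺ (inj₂ (x∈⁅x⁆ y))
  ... | no  y≢x  = x∈p∪q⁺ (inj₁ (x∈p∧x∉q⇒x∈p─q y∈p (y≢x ∘ x∈⁅y⁆⇒x≡y x)))

∣p─q∣+∣p─r∣≤∣p∣+∣∁[q∪r]∣ : ∀ (p q r : Subset n) → ∣ p ─ q ∣ + ∣ p ─ r ∣ ≤ ∣ p ∣ + ∣ ∁ (q ∪ r) ∣
∣p─q∣+∣p─r∣≤∣p∣+∣∁[q∪r]∣ p q r = begin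
  ∣ p ─ q ∣ + ∣ p ─ r ∣                              ≡⟨ ∣p∪q∣+∣p∩q∣≡∣p∣+∣q∣ (p ─ q) (p ─ r) ⟨
  ∣ (p ─ q) ∪ (p ─ r) ∣ + ∣ (p ─ q) ∩ (p ─ r) ∣     ≤⟨ +-mono-≤ (p⊆q⇒∣p∣≤∣q∣ ∪⊆p) (p⊆q⇒∣p∣≤∣q∣ ∩⊆∁[q∪r]) ⟩
  ∣ p ∣ + ∣ ∁ (q ∪ r) ∣                              ∎
  where
  open ≤-Reasoning
  ∪⊆p : (p ─ q) ∪ (p ─ r) ⊆ p
  ∪⊆p x∈ with x∈p∪q⁻ (p ─ q) (p ─ r) x∈
  ... | inj₁ x∈p─q = p─q⊆p p q x∈p─q
  ... | inj₂ x∈p─r = p─q⊆p p r x∈p─r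
  ∩⊆∁[q∪r] : (p ─ q) ∩ (p ─ r) ⊆ ∁ (q ∪ r)
  ∩⊆∁[q∪r] x∈ with x∈p∩q⁻ (p ─ q) (p ─ r) x∈
  ... | x∈p─q , x∈p─r = x∉p⇒x∈∁p λ x∈q∪r → case x∈p∪q⁻ q r x∈q∪r of λ where
    (inj₁ x∈q) → x∈q⇒x∉p─q p x∈q x∈p─q
    (inj₂ x∈r) → x∈q⇒x∉p─q p x∈r x∈p─r

∃-⊆-between : ∀ t {a p : Subset n} → a ⊆ p → ∣ a ∣ ≤ t → t ≤ ∣ p ∣ →
  ∃ λ q → a ⊆ q × q ⊆ p × ∣ q ∣ ≡ t
∃-⊆-between t {[]}          {[]}          _   _ z≤n = [] , (λ ()) , (λ ()) , refl
∃-⊆-between t {inside  ∷ a} {outside ∷ p} a⊆p _   _ = contradiction (a⊆p here) λ ()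
∃-⊆-between t {outside ∷ a} {outside ∷ p} a⊆p a≤t t≤p
  with q , a⊆q , q⊆p , ∣q∣≡t ← ∃-⊆-between t (drop-∷-⊆ a⊆p) a≤t t≤p =
  outside ∷ q , out⊆ a⊆q , out⊆ q⊆p , ∣q∣≡t
∃-⊆-between (suc t) {inside ∷ a} {inside ∷ p} a⊆p (s≤s a≤t) (s≤s t≤p)
  with q , a⊆q , q⊆p , ∣q∣≡t ← ∃-⊆-between t (drop-∷-⊆ a⊆p) a≤t t≤p =
  inside ∷ q , s⊆s a⊆q , s⊆s q⊆p , cong suc ∣q∣≡t
∃-⊆-between t {outside ∷ a} {inside ∷ p} a⊆p a≤t t≤1+p with t ≤? ∣ p ∣
... | no t≰p = inside ∷ p , out⊆ (drop-∷-⊆ a⊆p) , ⊆-refl , ≤-antisym (≰⇒> t≰p) t≤1+p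
... | yes t≤p with q , a⊆q , q⊆p , ∣q∣≡t ← ∃-⊆-between t (drop-∷-⊆ a⊆p) a≤t t≤p =
  outside ∷ q , out⊆ a⊆q , out⊆ q⊆p , ∣q∣≡t

∃-subset-of-size : ∀ {n k} → k ≤ n → ∃ λ (S : Subset n) → ∣ S ∣ ≡ k
∃-subset-of-size {n} {k} k≤n
  with S , _ , _ , ∣S∣≡k ← ∃-⊆-between k (⊥⊆ {p = ⊤}) (subst (_≤ k) (sym (∣⊥∣≡0 n)) z≤n)
                                                      (subst (k ≤_) (sym (∣⊤∣≡n n)) k≤n) =
  S , ∣S∣≡k

∃-separator : ∀ {t} {x w : Fin n} → x ≢ w → 1 ≤ t → t ≤ n ∸ 1 →
  ∃ λ (V : Subset n) → x ∉ V × w ∈ V × ∣ V ∣ ≡ t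
∃-separator {n} {t} {x} {w} x≢w 1≤t t≤n∸1 =
  let V , ⁅w⁆⊆V , V⊆∁⁅x⁆ , ∣V∣≡t = ∃-⊆-between t ⁅w⁆⊆∁⁅x⁆ ∣⁅w⁆∣≤t t≤∣∁⁅x⁆∣
  in V , (λ x∈V → x∈∁p⇒x∉p (V⊆∁⁅x⁆ x∈V) (x∈⁅x⁆ x)) , ⁅w⁆⊆V (x∈⁅x⁆ w) , ∣V∣≡t
  where
  ⁅w⁆⊆∁⁅x⁆ : ⁅ w ⁆ ⊆ ∁ ⁅ x ⁆
  ⁅w⁆⊆∁⁅x⁆ y∈⁅w⁆ rewrite x∈⁅y⁆⇒x≡y w y∈⁅w⁆ = x∉p⇒x∈∁p (x≢w ∘ sym ∘ x∈⁅y⁆⇒x≡y x)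
  ∣⁅w⁆∣≤t : ∣ ⁅ w ⁆ ∣ ≤ t
  ∣⁅w⁆∣≤t = subst (_≤ t) (sym (∣⁅x⁆∣≡1 w)) 1≤t
  t≤∣∁⁅x⁆∣ : t ≤ ∣ ∁ ⁅ x ⁆ ∣
  t≤∣∁⁅x⁆∣ = subst (t ≤_) (sym (trans (∣∁p∣≡n∸∣p∣ ⁅ x ⁆) (cong (n ∸_) (∣⁅x⁆∣≡1 x)))) t≤n∸1

infix 4 _⊆ᴳ_
infixl 6 _∪ᴳ_

_⊆ᴳ_ : Graph n → Graph n → Set
G ⊆ᴳ H = ∀ a b → G a b ≡ true → H a b ≡ true

_∪ᴳ_ : Graph n → Graph n → Graph n
(G ∪ᴳ H) a b = G a b ∨ H a b

-- deleteEdge G u v a b unfolds to: if edgeGraph u v a b then false else G a b.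
edgeGraph : Fin n → Fin n → Graph n
edgeGraph u v a b = (⌊ a ≟ u ⌋ ∧ ⌊ b ≟ v ⌋) ∨ (⌊ a ≟ v ⌋ ∧ ⌊ b ≟ u ⌋)

induced : Graph n → Subset n → Graph n
induced G P a b = G a b ∧ (lookup P a ∧ lookup P b)

-- does rather than ⌊_⌋, so that clique (s ∷ S) (suc a) (suc b) reduces to clique S a b.
clique : Subset n → Graph n
clique S a b = (lookup S a ∧ lookup S b) ∧ not (does (a ≟ b))

support : Graph n → Subset n
support {n} G = tabulate (λ a → any (G a) (allFin n))

∨-true⁻ : ∀ x {y} → x ∨ y ≡ true → x ≡ true ⊎ y ≡ true
∨-true⁻ true  _ = inj₁ refl
∨-true⁻ false e = inj₂ e

⌊≟⌋∧⌊≟⌋⁻ : ∀ (a u b v : Fin n) → ⌊ a ≟ u ⌋ ∧ ⌊ b ≟ v ⌋ ≡ true → a ≡ u × b ≡ v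
⌊≟⌋∧⌊≟⌋⁻ a u b v e with a ≟ u | b ≟ v
... | yes a≡u | yes b≡v = a≡u , b≡v
... | yes _   | no  _   = case e of λ ()
... | no  _   | _       = case e of λ ()

edgeGraph⁻ : ∀ (u v a b : Fin n) → edgeGraph u v a b ≡ true → (a ≡ u × b ≡ v) ⊎ (a ≡ v × b ≡ u)
edgeGraph⁻ u v a b e with ∨-true⁻ (⌊ a ≟ u ⌋ ∧ ⌊ b ≟ v ⌋) e
... | inj₁ e₁ = inj₁ (⌊≟⌋∧⌊≟⌋⁻ a u b v e₁)
... | inj₂ e₂ = inj₂ (⌊≟⌋∧⌊≟⌋⁻ a v b u e₂)

edgeGraph-endpoints : ∀ (u v : Fin n) → edgeGraph u v u v ≡ true
edgeGraph-endpoints u v with u ≟ u | v ≟ v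
... | yes _   | yes _   = refl
... | no  u≢u | _       = contradiction refl u≢u
... | yes _   | no  v≢v = contradiction refl v≢v

edgeGraph-sym : ∀ (u v a b : Fin n) → edgeGraph u v a b ≡ edgeGraph u v b a
edgeGraph-sym u v a b = trans (∨-comm (⌊ a ≟ u ⌋ ∧ ⌊ b ≟ v ⌋) _)
  (cong₂ _∨_ (∧-comm ⌊ a ≟ v ⌋ _) (∧-comm ⌊ a ≟ u ⌋ _))

edgeGraph⁺ : ∀ (u v a b : Fin n) → (a ≡ u × b ≡ v) ⊎ (a ≡ v × b ≡ u) → edgeGraph u v a b ≡ true
edgeGraph⁺ u v a b (inj₁ (refl , refl)) = edgeGraph-endpoints u v
edgeGraph⁺ u v a b (inj₂ (refl , refl)) = trans (edgeGraph-sym u v v u) (edgeGraph-endpoints u v)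

deleteEdge-endpoints : ∀ (G : Graph n) u v → deleteEdge G u v u v ≡ false
deleteEdge-endpoints G u v rewrite edgeGraph-endpoints u v = refl

deleteEdge-⊆ : ∀ (G : Graph n) u v → deleteEdge G u v ⊆ᴳ G
deleteEdge-⊆ G u v a b e with edgeGraph u v a b
... | false = e
... | true  = case e of λ ()

deleteEdge-mono : ∀ (u v : Fin n) → H ⊆ᴳ G → deleteEdge H u v ⊆ᴳ deleteEdge G u v
deleteEdge-mono u v H⊆G a b e with edgeGraph u v a b
... | false = H⊆G a b e
... | true  = e

⊆-deleteEdge : H ⊆ᴳ G → (∀ a b → H a b ≡ true → edgeGraph u v a b ≡ false) →
               H ⊆ᴳ deleteEdge G u v
⊆-deleteEdge {u = u} {v = v} H⊆G avoids a b e with edgeGraph u v a b | avoids a b e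
... | false | _ = H⊆G a b e

deleteEdge-∪ᴳ-edgeGraph : ∀ (G : Graph n) u v → deleteEdge (G ∪ᴳ edgeGraph u v) u v ⊆ᴳ G
deleteEdge-∪ᴳ-edgeGraph G u v a b e with edgeGraph u v a b
... | false = trans (sym (∨-identityʳ (G a b))) e
... | true  = case e of λ ()

∪ᴳ-upperˡ : ∀ (G H : Graph n) → G ⊆ᴳ G ∪ᴳ H
∪ᴳ-upperˡ G H a b e rewrite e = refl

∪ᴳ-upperʳ : ∀ (G H : Graph n) → H ⊆ᴳ G ∪ᴳ H
∪ᴳ-upperʳ G H a b e rewrite e = ∨-zeroʳ (G a b)

⊆-∪ᴳ : ∀ {G H₁ H₂ : Graph n} → (∀ a b → G a b ≡ true → H₁ a b ≡ true ⊎ H₂ a b ≡ true) →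
  G ⊆ᴳ H₁ ∪ᴳ H₂
⊆-∪ᴳ {H₁ = H₁} {H₂} cover a b e = [ ∪ᴳ-upperˡ H₁ H₂ a b , ∪ᴳ-upperʳ H₁ H₂ a b ] (cover a b e)

deleteEdge-simple : ∀ (u v : Fin n) → IsSimple G → IsSimple (deleteEdge G u v)
deleteEdge-simple {G = G} u v (G-sym , G-loopless) = symmetric , loopless
  where
  symmetric : ∀ a b → deleteEdge G u v a b ≡ deleteEdge G u v b a
  symmetric a b = cong₂ (λ e x → if e then false else x) (edgeGraph-sym u v a b) (G-sym a b)
  loopless : ∀ a → deleteEdge G u v a a ≡ false
  loopless a with edgeGraph u v a a
  ... | true  = refl
  ... | false = G-loopless a

∪ᴳ-simple : IsSimple G → IsSimple H → IsSimple (G ∪ᴳ H)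
∪ᴳ-simple (G-sym , G-loopless) (H-sym , H-loopless) =
  (λ a b → cong₂ _∨_ (G-sym a b) (H-sym a b)) , λ a → cong₂ _∨_ (G-loopless a) (H-loopless a)

edgeGraph-simple : u ≢ v → IsSimple (edgeGraph u v)
edgeGraph-simple {u = u} {v = v} u≢v = edgeGraph-sym u v , loopless
  where
  loopless : ∀ a → edgeGraph u v a a ≡ false
  loopless a = ¬-not λ e → u≢v (case edgeGraph⁻ u v a a e of λ where
    (inj₁ (a≡u , a≡v)) → trans (sym a≡u) a≡v
    (inj₂ (a≡v , a≡u)) → trans (sym a≡u) a≡v)

induced-simple : ∀ (P : Subset n) → IsSimple G → IsSimple (induced G P)
induced-simple P (G-sym , G-loopless) =
  (λ a b → cong₂ _∧_ (G-sym a b) (∧-comm (lookup P a) _)) , λ a → cong (_∧ _) (G-loopless a)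

does-≟-sym : ∀ (a b : Fin n) → does (a ≟ b) ≡ does (b ≟ a)
does-≟-sym a b with a ≟ b | b ≟ a
... | yes _   | yes _   = refl
... | no  _   | no  _   = refl
... | yes a≡b | no  b≢a = contradiction (sym a≡b) b≢a
... | no  a≢b | yes b≡a = contradiction (sym b≡a) a≢b

clique-simple : ∀ (S : Subset n) → IsSimple (clique S)
clique-simple S = symmetric , loopless
  where
  symmetric : ∀ a b → clique S a b ≡ clique S b a
  symmetric a b = cong₂ _∧_ (∧-comm (lookup S a) _) (cong not (does-≟-sym a b))
  loopless : ∀ a → clique S a a ≡ false
  loopless a with a ≟ a
  ... | yes _   = ∧-zeroʳ _
  ... | no  a≢a = contradiction refl a≢a

induced⁺ : ∀ (G : Graph n) P {a b} → G a b ≡ true → a ∈ P → b ∈ P → induced G P a b ≡ true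
induced⁺ G P Gab a∈P b∈P rewrite Gab | []=⇒lookup a∈P | []=⇒lookup b∈P = refl

induced⁻ : ∀ (G : Graph n) P a b → induced G P a b ≡ true → G a b ≡ true × a ∈ P × b ∈ P
induced⁻ G P a b e with G a b | lookup P a in a∈P | lookup P b in b∈P
... | true | true | true = refl , lookup⇒[]= a P a∈P , lookup⇒[]= b P b∈P

clique⁺ : ∀ {S : Subset n} → a ∈ S → b ∈ S → a ≢ b → clique S a b ≡ true
clique⁺ {a = a} {b = b} a∈S b∈S a≢b rewrite []=⇒lookup a∈S | []=⇒lookup b∈S with a ≟ b
... | yes a≡b = contradiction a≡b a≢b
... | no  _   = refl

clique⁻ : ∀ (S : Subset n) a b → clique S a b ≡ true → a ∈ S × b ∈ S
clique⁻ S a b e with lookup S a in a∈S | lookup S b in b∈S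
... | true  | true  = lookup⇒[]= a S a∈S , lookup⇒[]= b S b∈S

∈-support⁺ : ∀ (G : Graph n) {a b} → G a b ≡ true → a ∈ support G
∈-support⁺ G {a} {b} e =
  ∈-tabulate⁺ (Equivalence.to T-≡ (any⁺ (G a) (tabulate⁺ b (Equivalence.from T-≡ e))))

∈-support⁻ : ∀ (G : Graph n) {a} → a ∈ support G → ∃ λ b → G a b ≡ true
∈-support⁻ {n} G {a} a∈
  with b , Gab ← tabulate⁻ (any⁻ (G a) (allFin n) (Equivalence.from T-≡ (∈-tabulate⁻ a∈))) =
  b , Equivalence.to T-≡ Gab

∉-support : ∀ (G : Graph n) {a} → a ∉ support G → ∀ b → G a b ≡ false
∉-support G a∉ b = ¬-not λ e → a∉ (∈-support⁺ G e)

support-clique : ∀ (S : Subset n) → 2 ≤ ∣ S ∣ → support (clique S) ≡ S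
support-clique S 2≤∣S∣ = ⊆-antisym support⊆S S⊆support
  where
  support⊆S : support (clique S) ⊆ S
  support⊆S a∈ with b , e ← ∈-support⁻ (clique S) a∈ = proj₁ (clique⁻ S _ b e)
  S⊆support : S ⊆ support (clique S)
  S⊆support {a} a∈S with b , b∈S-a ← 0<∣p∣⇒Nonempty (s≤s⁻¹ (≤-trans 2≤∣S∣ (∣p∣≤1+∣p-x∣ S a))) =
    ∈-support⁺ (clique S) (clique⁺ a∈S (p─q⊆p S ⁅ a ⁆ b∈S-a)
      λ { refl → x∈q⇒x∉p─q S (x∈⁅x⁆ a) b∈S-a })

support-∪ᴳ-edgeGraph : ∀ (G : Graph n) {x w} → w ∈ support G →
  support (G ∪ᴳ edgeGraph x w) ≡ ⁅ x ⁆ ∪ support G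
support-∪ᴳ-edgeGraph {n} G {x} {w} w∈ = ⊆-antisym ⊆⁅x⁆∪ ⁅x⁆∪⊆
  where
  G⁺ : Graph n
  G⁺ = G ∪ᴳ edgeGraph x w
  ⊆⁅x⁆∪ : support G⁺ ⊆ ⁅ x ⁆ ∪ support G
  ⊆⁅x⁆∪ {a} a∈ with b , e ← ∈-support⁻ G⁺ a∈ with ∨-true⁻ (G a b) e
  ... | inj₁ Gab = x∈p∪q⁺ (inj₂ (∈-support⁺ G Gab))
  ... | inj₂ xw∋ab with edgeGraph⁻ x w a b xw∋ab
  ...   | inj₁ (refl , _) = x∈p∪q⁺ (inj₁ (x∈⁅x⁆ a))
  ...   | inj₂ (refl , _) = x∈p∪q⁺ (inj₂ w∈)
  ⁅x⁆∪⊆ : ⁅ x ⁆ ∪ support G ⊆ support G⁺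
  ⁅x⁆∪⊆ {a} a∈ with x∈p∪q⁻ ⁅ x ⁆ (support G) a∈
  ... | inj₁ a∈⁅x⁆ rewrite x∈⁅y⁆⇒x≡y x a∈⁅x⁆ =
    ∈-support⁺ G⁺ (∪ᴳ-upperʳ G (edgeGraph x w) x w (edgeGraph-endpoints x w))
  ... | inj₂ a∈G with b , e ← ∈-support⁻ G a∈G = ∈-support⁺ G⁺ (∪ᴳ-upperˡ G (edgeGraph x w) a b e)

support-induced-∁ : ∀ (G : Graph n) W → support (induced G (∁ W)) ⊆ support G ─ W
support-induced-∁ G W a∈ with b , e ← ∈-support⁻ (induced G (∁ W)) a∈
                         with Gab , a∈∁W , _ ← induced⁻ G (∁ W) _ b e =
  x∈p∧x∉q⇒x∈p─q (∈-support⁺ G Gab) (x∈∁p⇒x∉p a∈∁W)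

∣support-induced-∁∣< : ∀ {G : Graph n} W → IsSimple G → G u v ≡ true → u ∈ W ⊎ v ∈ W →
  ∣ support (induced G (∁ W)) ∣ < ∣ support G ∣
∣support-induced-∁∣< {u = u} {v} {G} W (G-sym , _) Guv uv∩W =
  ≤-<-trans (p⊆q⇒∣p∣≤∣q∣ (support-induced-∁ G W)) (p∩q≢∅⇒∣p─q∣<∣p∣ (support G) W endpoint∈)
  where
  endpoint∈ : Nonempty (support G ∩ W)
  endpoint∈ = [ (λ u∈W → u , x∈p∩q⁺ (∈-support⁺ G Guv , u∈W))
              , (λ v∈W → v , x∈p∩q⁺ (∈-support⁺ G (trans (G-sym v u) Guv) , v∈W)) ] uv∩W

isolatedCount≡n∸∣support∣ : ∀ (G : Graph n) → isolatedCount G ≡ n ∸ ∣ support G ∣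
isolatedCount≡n∸∣support∣ {n} G = begin
  isolatedCount G                  ≡⟨ sum-map-allFin (𝟙 ∘ isIsolatedᵇ G) ⟩
  ∑[ a < n ] 𝟙 (isIsolatedᵇ G a)   ≡⟨ ∣tabulate∣≡∑ (isIsolatedᵇ G) ⟨
  ∣ tabulate (isIsolatedᵇ G) ∣     ≡⟨ cong ∣_∣ (tabulate-∘ not (λ a → any (G a) (allFin n))) ⟩
  ∣ ∁ (support G) ∣                ≡⟨ ∣∁p∣≡n∸∣p∣ (support G) ⟩
  n ∸ ∣ support G ∣                ∎
  where open ≡-Reasoning

isolatedCount≡n∸k⇒∣support∣≡k : ∀ {G : Graph n} {k} → k ≤ n → isolatedCount G ≡ n ∸ k → ∣ support G ∣ ≡ k
isolatedCount≡n∸k⇒∣support∣≡k {G = G} k≤n isolated =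
  ∸-cancelˡ-≡ (∣p∣≤n (support G)) k≤n (trans (sym (isolatedCount≡n∸∣support∣ G)) isolated)

edgeSum : Graph n → ℕ
edgeSum {n} G = ∑[ a < n ] ∑[ b < n ] 𝟙 ((toℕ a <ᵇ toℕ b) ∧ G a b)

edgeSum-suc : ∀ (G : Graph (suc n)) →
  edgeSum G ≡ ∑[ b < n ] 𝟙 (G Fin.zero (Fin.suc b)) + edgeSum (λ a b → G (Fin.suc a) (Fin.suc b))
edgeSum-suc G = refl

edgeCount≡edgeSum : ∀ (G : Graph n) → edgeCount G ≡ edgeSum G
edgeCount≡edgeSum {n} G = begin
  edgeCount G                               ≡⟨ sum-cartesianProductWith pair (allFin n) (allFin n) ⟩
  listSum (map row (allFin n))              ≡⟨ sum-map-allFin row ⟩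
  ∑[ a < n ] listSum (map (pair a) (allFin n)) ≡⟨ sum-cong-≗ (sum-map-allFin ∘ pair) ⟩
  edgeSum G                                 ∎
  where
  open ≡-Reasoning
  pair : Fin n → Fin n → ℕ
  pair a b = 𝟙 ((toℕ a <ᵇ toℕ b) ∧ G a b)
  row : Fin n → ℕ
  row a = listSum (map (pair a) (allFin n))

𝟙-∧-monoʳ : ∀ l {x y} → (x ≡ true → y ≡ true) → 𝟙 (l ∧ x) ≤ 𝟙 (l ∧ y)
𝟙-∧-monoʳ false _   = z≤n
𝟙-∧-monoʳ true  x⇒y = 𝟙-mono x⇒y

𝟙-∧-∨ : ∀ l x y → 𝟙 (l ∧ (x ∨ y)) ≤ 𝟙 (l ∧ x) + 𝟙 (l ∧ y)
𝟙-∧-∨ false _     _ = z≤n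
𝟙-∧-∨ true  true  _ = s≤s z≤n
𝟙-∧-∨ true  false _ = ≤-refl

edgeCount-mono : G ⊆ᴳ H → edgeCount G ≤ edgeCount H
edgeCount-mono {G = G} {H = H} G⊆H rewrite edgeCount≡edgeSum G | edgeCount≡edgeSum H =
  sum-mono λ a → sum-mono λ b → 𝟙-∧-monoʳ (toℕ a <ᵇ toℕ b) (G⊆H a b)

edgeCount-∪ᴳ : ∀ (G H : Graph n) → edgeCount (G ∪ᴳ H) ≤ edgeCount G + edgeCount H
edgeCount-∪ᴳ G H rewrite edgeCount≡edgeSum (G ∪ᴳ H) | edgeCount≡edgeSum G | edgeCount≡edgeSum H =
  sum-mono-+ λ a → sum-mono-+ λ b → 𝟙-∧-∨ (toℕ a <ᵇ toℕ b) (G a b) (H a b)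

[1+m]C2≡m+mC2 : ∀ m → suc m C 2 ≡ m + m C 2
[1+m]C2≡m+mC2 m = trans (sym (nCk+nC[k+1]≡[n+1]C[k+1] m 1)) (cong (_+ m C 2) (nC1≡n m))

edgeSum-clique : ∀ (S : Subset n) → edgeSum (clique S) ≡ ∣ S ∣ C 2
edgeSum-clique []            = refl
edgeSum-clique {suc n} (outside ∷ S) = cong₂ _+_ (sum-replicate-zero n) (edgeSum-clique S)
edgeSum-clique {suc n} (inside  ∷ S) = begin
  edgeSum (clique (inside ∷ S))
    ≡⟨ edgeSum-suc (clique (inside ∷ S)) ⟩
  ∑[ b < n ] 𝟙 (lookup S b ∧ true) + edgeSum (clique S)
    ≡⟨ cong₂ _+_ (trans (sum-cong-≗ (cong 𝟙 ∘ ∧-identityʳ ∘ lookup S)) (sym (∣p∣≡∑ S)))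
                 (edgeSum-clique S) ⟩
  ∣ S ∣ + ∣ S ∣ C 2
    ≡⟨ [1+m]C2≡m+mC2 ∣ S ∣ ⟨
  suc ∣ S ∣ C 2 ∎
  where open ≡-Reasoning

edgeCount-clique : ∀ (S : Subset n) → edgeCount (clique S) ≡ ∣ S ∣ C 2
edgeCount-clique S = trans (edgeCount≡edgeSum (clique S)) (edgeSum-clique S)

edgeCount≤∣support∣C2 : ∀ {G : Graph n} → IsSimple G → edgeCount G ≤ ∣ support G ∣ C 2
edgeCount≤∣support∣C2 {G = G} (G-sym , G-loopless) =
  ≤-trans (edgeCount-mono G⊆clique) (≤-reflexive (edgeCount-clique (support G)))
  where
  G⊆clique : G ⊆ᴳ clique (support G)
  G⊆clique a b e = clique⁺ (∈-support⁺ G e) (∈-support⁺ G (trans (G-sym b a) e))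
                           λ { refl → case trans (sym e) (G-loopless a) of λ () }

edgeCount≡0 : ∀ {G : Graph n} → IsSimple G → Empty (support G) → edgeCount G ≡ 0
edgeCount≡0 {G = G} G-simple G-edgeless =
  n≤0⇒n≡0 (subst (λ s → edgeCount G ≤ s C 2) (∣Empty∣≡0 G-edgeless) (edgeCount≤∣support∣C2 G-simple))

m≤2⇒mC2≤1 : ∀ {m} → m ≤ 2 → m C 2 ≤ 1
m≤2⇒mC2≤1 z≤n             = z≤n
m≤2⇒mC2≤1 (s≤s z≤n)       = z≤n
m≤2⇒mC2≤1 (s≤s (s≤s z≤n)) = ≤-refl

edgeCount-edgeGraph : ∀ {u v : Fin n} → u ≢ v → edgeCount (edgeGraph u v) ≤ 1
edgeCount-edgeGraph {n} {u} {v} u≢v = begin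
  edgeCount (edgeGraph u v)       ≤⟨ edgeCount-mono edgeGraph⊆clique ⟩
  edgeCount (clique ⁅u⁆∪⁅v⁆)      ≡⟨ edgeCount-clique ⁅u⁆∪⁅v⁆ ⟩
  ∣ ⁅u⁆∪⁅v⁆ ∣ C 2                 ≤⟨ m≤2⇒mC2≤1 ∣⁅u⁆∪⁅v⁆∣≤2 ⟩
  1                               ∎
  where
  open ≤-Reasoning
  ⁅u⁆∪⁅v⁆ : Subset n
  ⁅u⁆∪⁅v⁆ = ⁅ u ⁆ ∪ ⁅ v ⁆
  u∈ : u ∈ ⁅u⁆∪⁅v⁆
  u∈ = x∈p∪q⁺ (inj₁ (x∈⁅x⁆ u))
  v∈ : v ∈ ⁅u⁆∪⁅v⁆
  v∈ = x∈p∪q⁺ (inj₂ (x∈⁅x⁆ v))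
  edgeGraph⊆clique : edgeGraph u v ⊆ᴳ clique ⁅u⁆∪⁅v⁆
  edgeGraph⊆clique a b e with edgeGraph⁻ u v a b e
  ... | inj₁ (refl , refl) = clique⁺ u∈ v∈ u≢v
  ... | inj₂ (refl , refl) = clique⁺ v∈ u∈ (u≢v ∘ sym)
  ∣⁅u⁆∪⁅v⁆∣≤2 : ∣ ⁅u⁆∪⁅v⁆ ∣ ≤ 2
  ∣⁅u⁆∪⁅v⁆∣≤2 = subst₂ (λ p q → ∣ ⁅u⁆∪⁅v⁆ ∣ ≤ p + q) (∣⁅x⁆∣≡1 u) (∣⁅x⁆∣≡1 v) (∣p∪q∣≤∣p∣+∣q∣ ⁅ u ⁆ ⁅ v ⁆)

JEraseAllowed-⊆ : H ⊆ᴳ G → JEraseAllowed j G u v → JEraseAllowed j H u v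
JEraseAllowed-⊆ _    (inj₁ n≡1+j) = inj₁ n≡1+j
JEraseAllowed-⊆ H⊆G (inj₂ (V₁ , V₂ , disjoint , size , ends , only)) =
  inj₂ (V₁ , V₂ , disjoint , size , ends , λ a b a∈V₁ b∈V₂ → only a b a∈V₁ b∈V₂ ∘ H⊆G a b)

absent-edge-avoided : IsSimple H → H u v ≡ false →
                      ∀ a b → H a b ≡ true → edgeGraph u v a b ≡ false
absent-edge-avoided {u = u} {v = v} (H-sym , _) Huv a b e with edgeGraph u v a b in uv∋ab
... | false = refl
... | true with edgeGraph⁻ u v a b uv∋ab
...   | inj₁ (refl , refl) = case trans (sym e) Huv of λ ()
...   | inj₂ (refl , refl) = case trans (sym (trans (H-sym u v) e)) Huv of λ ()

JErasable-⊆ : JErasable j G → IsSimple H → H ⊆ᴳ G → JErasable j H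
JErasable-⊆ (done G-edgeless) _ H⊆G =
  done λ a b → ¬-not λ e → case trans (sym (H⊆G a b e)) (G-edgeless a b) of λ ()
JErasable-⊆ {H = H} (step u v _ erasable allowed) H-simple H⊆G with H u v in Huv
... | true  = step u v Huv
  (JErasable-⊆ erasable (deleteEdge-simple u v H-simple) (deleteEdge-mono u v H⊆G))
  (JEraseAllowed-⊆ H⊆G allowed)
... | false = JErasable-⊆ erasable H-simple (⊆-deleteEdge H⊆G (absent-edge-avoided H-simple Huv))

JErasable-if-allowed : ∀ {n j} {G : Graph n} → IsSimple G →
  (∀ H → IsSimple H → H ⊆ᴳ G → ∀ u v → H u v ≡ true → JEraseAllowed j H u v) →
  JErasable j G
JErasable-if-allowed {n} {j} {G} G-simple allowed =
  go (cartesianProduct (allFin n) (allFin n)) G-simple (λ _ _ e → e)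
     (λ a b _ → ∈-cartesianProduct⁺ (∈-allFin a) (∈-allFin b))
  where
  go : ∀ (L : List (Fin n × Fin n)) {H} → IsSimple H → H ⊆ᴳ G →
       (∀ a b → H a b ≡ true → (a , b) List.∈ L) → JErasable j H
  go [] _ _ listed = done λ a b → ¬-not λ e → case listed a b e of λ ()
  go ((u , v) ∷ L) {H} H-simple H⊆G listed with H u v in Huv
  ... | true = step u v Huv
    (go L (deleteEdge-simple u v H-simple) (λ a b → H⊆G a b ∘ deleteEdge-⊆ H u v a b) listed′)
    (allowed H H-simple H⊆G u v Huv)
    where
    listed′ : ∀ a b → deleteEdge H u v a b ≡ true → (a , b) List.∈ L
    listed′ a b e with listed a b (deleteEdge-⊆ H u v a b e)
    ... | here refl = case trans (sym e) (deleteEdge-endpoints H u v) of λ ()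
    ... | there ab∈L = ab∈L
  ... | false = go L H-simple H⊆G listed′
    where
    listed′ : ∀ a b → H a b ≡ true → (a , b) List.∈ L
    listed′ a b e with listed a b e
    ... | here refl = case trans (sym e) Huv of λ ()
    ... | there ab∈L = ab∈L

1+[n∸[1+j]]+j≡n : ∀ {n j} → suc j ≤ n → 1 + (n ∸ suc j) + j ≡ n
1+[n∸[1+j]]+j≡n {n} {j} 1+j≤n = begin
  1 + (n ∸ suc j) + j  ≡⟨ cong (_+ j) (+-comm 1 (n ∸ suc j)) ⟩
  n ∸ suc j + 1 + j    ≡⟨ +-assoc (n ∸ suc j) 1 j ⟩
  n ∸ suc j + suc j    ≡⟨ m∸n+n≡m 1+j≤n ⟩
  n                    ∎
  where open ≡-Reasoning

JEraseAllowed-⁅⁆ : ∀ {n j} {H : Graph n} {u v} → suc j ≤ n →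
  ∀ (V : Subset n) → u ∉ V → v ∈ V → ∣ V ∣ ≡ n ∸ suc j →
  (∀ b → b ∈ V → H u b ≡ true → b ≡ v) → JEraseAllowed j H u v
JEraseAllowed-⁅⁆ {n} {j} {H} {u} {v} 1+j≤n V u∉V v∈V ∣V∣≡n∸[1+j] only-v =
  inj₂ (⁅ u ⁆ , V , disjoint , size , inj₁ (x∈⁅x⁆ u , v∈V) , only)
  where
  disjoint : ∀ x → x ∈ ⁅ u ⁆ → x ∉ V
  disjoint x x∈⁅u⁆ rewrite x∈⁅y⁆⇒x≡y u x∈⁅u⁆ = u∉V
  size : ∣ ⁅ u ⁆ ∣ + ∣ V ∣ + j ≡ n
  size rewrite ∣⁅x⁆∣≡1 u | ∣V∣≡n∸[1+j] = 1+[n∸[1+j]]+j≡n 1+j≤n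
  only : ∀ a b → a ∈ ⁅ u ⁆ → b ∈ V → H a b ≡ true → (a ≡ u × b ≡ v) ⊎ (a ≡ v × b ≡ u)
  only a b a∈⁅u⁆ b∈V e with refl ← x∈⁅y⁆⇒x≡y u a∈⁅u⁆ = inj₁ (refl , only-v b b∈V e)

-- Cliques on at most j + 2 vertices

clique-allowed : ∀ {n j} {S T : Subset n} {H : Graph n} {u v} → S ⊆ T → ∣ T ∣ ≡ 2 + j →
  H ⊆ᴳ clique S → H u v ≡ true → JEraseAllowed j H u v
clique-allowed {n} {j} {S} {T} {H} {u} {v} S⊆T ∣T∣≡2+j H⊆K Huv =
  JEraseAllowed-⁅⁆ (≤-trans (n≤1+n _) 2+j≤n) (⁅ v ⁆ ∪ ∁ T) u∉V (x∈p∪q⁺ (inj₁ (x∈⁅x⁆ v))) ∣V∣≡ only-v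
  where
  2+j≤n : 2 + j ≤ n
  2+j≤n = subst (_≤ n) ∣T∣≡2+j (∣p∣≤n T)
  u∈S×v∈S : u ∈ S × v ∈ S
  u∈S×v∈S = clique⁻ S u v (H⊆K u v Huv)
  u≢v : u ≢ v
  u≢v refl = case trans (sym (H⊆K u u Huv)) (proj₂ (clique-simple S) u) of λ ()
  u∉V : u ∉ ⁅ v ⁆ ∪ ∁ T
  u∉V u∈V with x∈p∪q⁻ ⁅ v ⁆ (∁ T) u∈V
  ... | inj₁ u∈⁅v⁆ = u≢v (x∈⁅y⁆⇒x≡y v u∈⁅v⁆)
  ... | inj₂ u∈∁T  = x∈∁p⇒x∉p u∈∁T (S⊆T (proj₁ u∈S×v∈S))
  ∣V∣≡ : ∣ ⁅ v ⁆ ∪ ∁ T ∣ ≡ n ∸ suc j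
  ∣V∣≡ = begin
    ∣ ⁅ v ⁆ ∪ ∁ T ∣      ≡⟨ ∣⁅x⁆∪p∣≡1+∣p∣ (x∈p⇒x∉∁p (S⊆T (proj₂ u∈S×v∈S))) ⟩
    suc ∣ ∁ T ∣          ≡⟨ cong suc (∣∁p∣≡n∸∣p∣ T) ⟩
    suc (n ∸ ∣ T ∣)      ≡⟨ cong (λ t → suc (n ∸ t)) ∣T∣≡2+j ⟩
    suc (n ∸ (2 + j))    ≡⟨ +-∸-assoc 1 2+j≤n ⟨
    n ∸ suc j            ∎
    where open ≡-Reasoning
  only-v : ∀ b → b ∈ ⁅ v ⁆ ∪ ∁ T → H u b ≡ true → b ≡ v
  only-v b b∈V e with x∈p∪q⁻ ⁅ v ⁆ (∁ T) b∈V
  ... | inj₁ b∈⁅v⁆ = x∈⁅y⁆⇒x≡y v b∈⁅v⁆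
  ... | inj₂ b∈∁T  = contradiction (S⊆T (proj₂ (clique⁻ S u b (H⊆K u b e)))) (x∈∁p⇒x∉p b∈∁T)

clique-erasable : ∀ {n j} (S : Subset n) → suc j ≤ n → ∣ S ∣ ≤ 2 + j → JErasable j (clique S)
clique-erasable {n} {j} S 1+j≤n ∣S∣≤2+j with n ≟ℕ suc j
... | yes n≡1+j = JErasable-if-allowed (clique-simple S) λ _ _ _ _ _ _ → inj₁ n≡1+j
... | no  n≢1+j
  with T , S⊆T , _ , ∣T∣≡2+j ← ∃-⊆-between (2 + j) (⊆⊤ {p = S}) ∣S∣≤2+j
                                 (subst (2 + j ≤_) (sym (∣⊤∣≡n n)) (≤∧≢⇒< 1+j≤n (n≢1+j ∘ sym))) =
  JErasable-if-allowed (clique-simple S) λ _ _ H⊆K _ _ → clique-allowed S⊆T ∣T∣≡2+j H⊆K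

clique-IsFj : ∀ {n j} (S : Subset n) → 2 ≤ ∣ S ∣ → ∣ S ∣ ≤ 2 + j → suc j ≤ n →
  IsFj n j ∣ S ∣ (∣ S ∣ C 2)
clique-IsFj {n} {j} S 2≤∣S∣ ∣S∣≤2+j 1+j≤n =
  (clique S , (clique-simple S , clique-erasable S 1+j≤n ∣S∣≤2+j , isolated) , edgeCount-clique S) ,
  maximal
  where
  isolated : isolatedCount (clique S) ≡ n ∸ ∣ S ∣
  isolated rewrite isolatedCount≡n∸∣support∣ (clique S) | support-clique S 2≤∣S∣ = refl
  maximal : ∀ G → Admissible n j ∣ S ∣ G → edgeCount G ≤ ∣ S ∣ C 2
  maximal G (G-simple , _ , G-isolated) rewrite sym (isolatedCount≡n∸k⇒∣support∣≡k (∣p∣≤n S) G-isolated) =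
    edgeCount≤∣support∣C2 G-simple

IsFj-C2 : ∀ {n j k} → 2 ≤ k → k ≤ 2 + j → suc j ≤ n → k ≤ n → IsFj n j k (k C 2)
IsFj-C2 2≤k k≤2+j 1+j≤n k≤n with S , refl ← ∃-subset-of-size k≤n = clique-IsFj S 2≤k k≤2+j 1+j≤n

-- Padding with pendant edges

pendant-simple : ∀ {G : Graph n} {x w} → IsSimple G → x ∉ support G → w ∈ support G →
  IsSimple (G ∪ᴳ edgeGraph x w)
pendant-simple G-simple x∉ w∈ = ∪ᴳ-simple G-simple (edgeGraph-simple λ { refl → x∉ w∈ })

pendant-erasable : ∀ {n j} {G : Graph n} {x w} → suc (suc j) ≤ n → IsSimple G →
  x ∉ support G → w ∈ support G → JErasable j G → JErasable j (G ∪ᴳ edgeGraph x w)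
pendant-erasable {n} {j} {G} {x} {w} 2+j≤n G-simple x∉ w∈ G-erasable
  with V , x∉V , w∈V , ∣V∣≡n∸[1+j]
         ← ∃-separator (λ { refl → x∉ w∈ }) (m<n⇒0<n∸m 2+j≤n) (∸-monoʳ-≤ n (s≤s z≤n)) =
  step x w (∪ᴳ-upperʳ G (edgeGraph x w) x w (edgeGraph-endpoints x w))
    (JErasable-⊆ G-erasable (deleteEdge-simple x w (pendant-simple G-simple x∉ w∈))
                            (deleteEdge-∪ᴳ-edgeGraph G x w))
    (JEraseAllowed-⁅⁆ (≤-trans (n≤1+n _) 2+j≤n) V x∉V w∈V ∣V∣≡n∸[1+j] λ b _ → only-w b)
  where
  only-w : ∀ b → (G ∪ᴳ edgeGraph x w) x b ≡ true → b ≡ w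
  only-w b e rewrite ∉-support G x∉ b with edgeGraph⁻ x w x b e
  ... | inj₁ (_ , b≡w)    = b≡w
  ... | inj₂ (refl , _) = contradiction w∈ x∉

grow-support : ∀ {n j} {G : Graph n} → suc (suc j) ≤ n → IsSimple G → JErasable j G →
  Nonempty (support G) → ∣ support G ∣ < n →
  Σ (Graph n) λ G⁺ → IsSimple G⁺ × JErasable j G⁺ × G ⊆ᴳ G⁺ × ∣ support G⁺ ∣ ≡ suc ∣ support G ∣
grow-support {G = G} 2+j≤n G-simple G-erasable (w , w∈) ∣G∣<n
  with x , x∈∁ ← 0<∣p∣⇒Nonempty (subst (0 <_) (sym (∣∁p∣≡n∸∣p∣ (support G))) (m<n⇒0<n∸m ∣G∣<n)) =
  G ∪ᴳ edgeGraph x w ,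
  pendant-simple G-simple (x∈∁p⇒x∉p x∈∁) w∈ ,
  pendant-erasable 2+j≤n G-simple (x∈∁p⇒x∉p x∈∁) w∈ G-erasable ,
  ∪ᴳ-upperˡ G (edgeGraph x w) ,
  trans (cong ∣_∣ (support-∪ᴳ-edgeGraph G w∈)) (∣⁅x⁆∪p∣≡1+∣p∣ (x∈∁p⇒x∉p x∈∁))

edgeCount≤-of-IsFj : ∀ {n j t m} {G : Graph n} → IsFj n j t m → suc (suc j) ≤ n → t ≤ n →
  IsSimple G → JErasable j G → ∣ support G ∣ ≤ t → edgeCount G ≤ m
edgeCount≤-of-IsFj {n} {j} {t} {m} {G} fj 2+j≤n t≤n G-simple G-erasable ∣G∣≤t =
  grow (t ∸ ∣ support G ∣) G-simple G-erasable (m+[n∸m]≡n ∣G∣≤t)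
  where
  grow : ∀ d {H : Graph n} → IsSimple H → JErasable j H → ∣ support H ∣ + d ≡ t → edgeCount H ≤ m
  grow zero {H} H-simple H-erasable ∣H∣+0≡t =
    proj₂ fj H (H-simple , H-erasable ,
                trans (isolatedCount≡n∸∣support∣ H) (cong (n ∸_) (trans (sym (+-identityʳ _)) ∣H∣+0≡t)))
  grow (suc d) {H} H-simple H-erasable ∣H∣+1+d≡t with nonempty? (support H)
  ... | no  H-edgeless = subst (_≤ m) (sym (edgeCount≡0 H-simple H-edgeless)) z≤n
  ... | yes H-nonempty
    with H⁺ , H⁺-simple , H⁺-erasable , H⊆H⁺ , ∣H⁺∣≡1+∣H∣
           ← grow-support 2+j≤n H-simple H-erasable H-nonempty
                          (≤-trans (≤-trans (m<m+n _ z<s) (≤-reflexive ∣H∣+1+d≡t)) t≤n) =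
    ≤-trans (edgeCount-mono H⊆H⁺)
            (grow d H⁺-simple H⁺-erasable
                  (trans (cong (_+ d) ∣H⁺∣≡1+∣H∣) (trans (sym (+-suc _ d)) ∣H∣+1+d≡t)))

-- Splitting at the first erased edge

induced-∁-⊆-deleteEdge : ∀ (G : Graph n) {W} → u ∈ W ⊎ v ∈ W → induced G (∁ W) ⊆ᴳ deleteEdge G u v
induced-∁-⊆-deleteEdge {u = u} {v} G {W} uv∩W = ⊆-deleteEdge (λ a b → proj₁ ∘ induced⁻ G (∁ W) a b) avoids
  where
  avoids : ∀ a b → induced G (∁ W) a b ≡ true → edgeGraph u v a b ≡ false
  avoids a b e with _ , a∈∁W , b∈∁W ← induced⁻ G (∁ W) a b e =
    ¬-not λ uv∋ab → case edgeGraph⁻ u v a b uv∋ab of λ where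
      (inj₁ (refl , refl)) → [ x∈∁p⇒x∉p a∈∁W , x∈∁p⇒x∉p b∈∁W ] uv∩W
      (inj₂ (refl , refl)) → [ x∈∁p⇒x∉p b∈∁W , x∈∁p⇒x∉p a∈∁W ] uv∩W

cut-⊆ : ∀ {G : Graph n} {u v} {V₁ V₂ : Subset n} → IsSimple G → (∀ x → x ∈ V₁ → x ∉ V₂) →
  (∀ a b → a ∈ V₁ → b ∈ V₂ → G a b ≡ true → (a ≡ u × b ≡ v) ⊎ (a ≡ v × b ≡ u)) →
  G ⊆ᴳ induced G (∁ V₁) ∪ᴳ induced G (∁ V₂) ∪ᴳ edgeGraph u v
cut-⊆ {G = G} {u} {v} {V₁} {V₂} (G-sym , _) disjoint only = ⊆-∪ᴳ cut
  where
  sides : ∀ a b → edgeGraph u v a b ≡ false → G a b ≡ true →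
          induced G (∁ V₁) a b ≡ true ⊎ induced G (∁ V₂) a b ≡ true
  sides a b uv∌ab e with a ∈? V₁ | b ∈? V₁
  ... | no a∉V₁  | no b∉V₁ = inj₁ (induced⁺ G (∁ V₁) e (x∉p⇒x∈∁p a∉V₁) (x∉p⇒x∈∁p b∉V₁))
  ... | yes a∈V₁ | _       =
    inj₂ (induced⁺ G (∁ V₂) e (x∉p⇒x∈∁p (disjoint a a∈V₁))
                     (x∉p⇒x∈∁p λ b∈V₂ → uv∌ab′ (only a b a∈V₁ b∈V₂ e)))
    where
    uv∌ab′ : ¬ ((a ≡ u × b ≡ v) ⊎ (a ≡ v × b ≡ u))
    uv∌ab′ ab≡uv = case trans (sym (edgeGraph⁺ u v a b ab≡uv)) uv∌ab of λ ()
  ... | no _     | yes b∈V₁ =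
    inj₂ (induced⁺ G (∁ V₂) e (x∉p⇒x∈∁p λ a∈V₂ → uv∌ba (only b a b∈V₁ a∈V₂ (trans (G-sym b a) e)))
                     (x∉p⇒x∈∁p (disjoint b b∈V₁)))
    where
    uv∌ba : ¬ ((b ≡ u × a ≡ v) ⊎ (b ≡ v × a ≡ u))
    uv∌ba ba≡uv = case trans (sym (trans (edgeGraph-sym u v a b) (edgeGraph⁺ u v b a ba≡uv))) uv∌ab of λ ()
  cut : ∀ a b → G a b ≡ true →
        (induced G (∁ V₁) ∪ᴳ induced G (∁ V₂)) a b ≡ true ⊎ edgeGraph u v a b ≡ true
  cut a b e with edgeGraph u v a b in uv∋ab
  ... | true  = inj₂ refl
  ... | false = inj₁ ([ ∪ᴳ-upperˡ (induced G (∁ V₁)) (induced G (∁ V₂)) a b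
                       , ∪ᴳ-upperʳ (induced G (∁ V₁)) (induced G (∁ V₂)) a b ]
                        (sides a b uv∋ab e))

edgeCount-cut : ∀ {G : Graph n} {u v} {V₁ V₂ : Subset n} → IsSimple G → G u v ≡ true →
  (∀ x → x ∈ V₁ → x ∉ V₂) →
  (∀ a b → a ∈ V₁ → b ∈ V₂ → G a b ≡ true → (a ≡ u × b ≡ v) ⊎ (a ≡ v × b ≡ u)) →
  edgeCount G ≤ edgeCount (induced G (∁ V₁)) + edgeCount (induced G (∁ V₂)) + 1
edgeCount-cut {n} {G} {u} {v} {V₁} {V₂} G-simple Guv disjoint only = begin
  edgeCount G                                        ≤⟨ edgeCount-mono (cut-⊆ G-simple disjoint only) ⟩
  edgeCount (G₁ ∪ᴳ G₂ ∪ᴳ edgeGraph u v)              ≤⟨ edgeCount-∪ᴳ (G₁ ∪ᴳ G₂) (edgeGraph u v) ⟩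
  edgeCount (G₁ ∪ᴳ G₂) + edgeCount (edgeGraph u v)   ≤⟨ +-mono-≤ (edgeCount-∪ᴳ G₁ G₂)
                                                                 (edgeCount-edgeGraph u≢v) ⟩
  edgeCount G₁ + edgeCount G₂ + 1                    ∎
  where
  open ≤-Reasoning
  G₁ G₂ : Graph n
  G₁ = induced G (∁ V₁)
  G₂ = induced G (∁ V₂)
  u≢v : u ≢ v
  u≢v refl = case trans (sym Guv) (proj₂ G-simple u) of λ ()

∣support-cut∣ : ∀ {n j} (G : Graph n) {V₁ V₂ : Subset n} → (∀ x → x ∈ V₁ → x ∉ V₂) →
  ∣ V₁ ∣ + ∣ V₂ ∣ + j ≡ n →
  ∣ support (induced G (∁ V₁)) ∣ + ∣ support (induced G (∁ V₂)) ∣ ≤ ∣ support G ∣ + j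
∣support-cut∣ {j = j} G {V₁} {V₂} disjoint size = begin
  ∣ support (induced G (∁ V₁)) ∣ + ∣ support (induced G (∁ V₂)) ∣
    ≤⟨ +-mono-≤ (p⊆q⇒∣p∣≤∣q∣ (support-induced-∁ G V₁)) (p⊆q⇒∣p∣≤∣q∣ (support-induced-∁ G V₂)) ⟩
  ∣ support G ─ V₁ ∣ + ∣ support G ─ V₂ ∣
    ≤⟨ ∣p─q∣+∣p─r∣≤∣p∣+∣∁[q∪r]∣ (support G) V₁ V₂ ⟩
  ∣ support G ∣ + ∣ ∁ (V₁ ∪ V₂) ∣
    ≡⟨ cong (∣ support G ∣ +_) (∣∁[p∪q]∣≡j disjoint size) ⟩
  ∣ support G ∣ + j ∎
  where open ≤-Reasoning

record ErasureSplit {n} (j : ℕ) (G : Graph n) : Set where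
  field
    G₁ G₂       : Graph n
    G₁-simple   : IsSimple G₁
    G₂-simple   : IsSimple G₂
    G₁-erasable : JErasable j G₁
    G₂-erasable : JErasable j G₂
    edgeCount≤  : edgeCount G ≤ edgeCount G₁ + edgeCount G₂ + 1
    ∣support₁∣< : ∣ support G₁ ∣ < ∣ support G ∣
    ∣support₂∣< : ∣ support G₂ ∣ < ∣ support G ∣
    ∣support₁∣+∣support₂∣≤ : ∣ support G₁ ∣ + ∣ support G₂ ∣ ≤ ∣ support G ∣ + j

erasure-split : ∀ {n j} {G : Graph n} {u v} → IsSimple G → G u v ≡ true →
  JErasable j (deleteEdge G u v) → ∀ (V₁ V₂ : Subset n) → (∀ x → x ∈ V₁ → x ∉ V₂) →
  ∣ V₁ ∣ + ∣ V₂ ∣ + j ≡ n → (u ∈ V₁ × v ∈ V₂) ⊎ (v ∈ V₁ × u ∈ V₂) →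
  (∀ a b → a ∈ V₁ → b ∈ V₂ → G a b ≡ true → (a ≡ u × b ≡ v) ⊎ (a ≡ v × b ≡ u)) →
  ErasureSplit j G
erasure-split {G = G} {u} {v} G-simple Guv rest V₁ V₂ disjoint size ends only = record
  { G₁ = induced G (∁ V₁)
  ; G₂ = induced G (∁ V₂)
  ; G₁-simple = induced-simple (∁ V₁) G-simple
  ; G₂-simple = induced-simple (∁ V₂) G-simple
  ; G₁-erasable = JErasable-⊆ rest (induced-simple (∁ V₁) G-simple) (induced-∁-⊆-deleteEdge G uv∩V₁)
  ; G₂-erasable = JErasable-⊆ rest (induced-simple (∁ V₂) G-simple) (induced-∁-⊆-deleteEdge G uv∩V₂)
  ; edgeCount≤ = edgeCount-cut G-simple Guv disjoint only
  ; ∣support₁∣< = ∣support-induced-∁∣< V₁ G-simple Guv uv∩V₁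
  ; ∣support₂∣< = ∣support-induced-∁∣< V₂ G-simple Guv uv∩V₂
  ; ∣support₁∣+∣support₂∣≤ = ∣support-cut∣ G disjoint size
  }
  where
  uv∩V₁ : u ∈ V₁ ⊎ v ∈ V₁
  uv∩V₁ = [ inj₁ ∘ proj₁ , inj₂ ∘ proj₁ ] ends
  uv∩V₂ : u ∈ V₂ ⊎ v ∈ V₂
  uv∩V₂ = [ inj₂ ∘ proj₂ , inj₁ ∘ proj₂ ] ends

JErasable-cases : ∀ {n j} {G : Graph n} → IsSimple G → JErasable j G →
  Empty (support G) ⊎ n ≡ suc j ⊎ ErasureSplit j G
JErasable-cases {G = G} _ (done G-edgeless) =
  inj₁ λ (a , a∈) → let b , Gab = ∈-support⁻ G a∈ in case trans (sym Gab) (G-edgeless a b) of λ ()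
JErasable-cases _ (step _ _ _ _ (inj₁ n≡1+j)) = inj₂ (inj₁ n≡1+j)
JErasable-cases G-simple (step _ _ Guv rest (inj₂ (V₁ , V₂ , disjoint , size , ends , only))) =
  inj₂ (inj₂ (erasure-split G-simple Guv rest V₁ V₂ disjoint size ends only))

split-sizes : ∀ {j k m₁ m₂} → j + 3 ≤ k → m₁ < k → m₂ < k → m₁ + m₂ ≤ k + j →
  Σ ℕ λ k₁ → Σ ℕ λ k₂ →
    (suc j ≤ k₁) × (k₁ ≤ k ∸ 1) × (suc j ≤ k₂) × (k₂ ≤ k ∸ 1) × (k₁ + k₂ ≡ k + j) ×
    (m₁ ≤ k₁) × (m₂ ≤ k₂)
split-sizes {j} {suc k} {m₁} {m₂} j+3≤1+k (s≤s m₁≤k) (s≤s m₂≤k) m₁+m₂≤1+k+j =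
  k₁ , suc k + j ∸ k₁ , m≤m⊔n (suc j) m₁ , k₁≤k , 1+j≤k₂ , k₂≤k ,
  m+[n∸m]≡n (≤-trans k₁≤k (≤-trans (n≤1+n k) (m≤m+n (suc k) j))) , m≤n⊔m (suc j) m₁ , m₂≤k₂
  where
  k₁ : ℕ
  k₁ = suc j ⊔ m₁
  1+j+k≡1+k+j : suc j + k ≡ suc k + j
  1+j+k≡1+k+j = cong suc (+-comm j k)
  k₁≤k : k₁ ≤ k
  k₁≤k = ⊔-lub (≤-trans (n≤1+n (suc j)) (s≤s⁻¹ (subst (_≤ suc k) (+-comm j 3) j+3≤1+k))) m₁≤k
  1+j≤k₂ : suc j ≤ suc k + j ∸ k₁
  1+j≤k₂ = m+n≤o⇒m≤o∸n (suc j) (subst (suc j + k₁ ≤_) 1+j+k≡1+k+j (+-monoʳ-≤ (suc j) k₁≤k))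
  k₂≤k : suc k + j ∸ k₁ ≤ k
  k₂≤k = m≤n+o⇒m∸n≤o (suc k + j) k₁ (subst (_≤ k₁ + k) 1+j+k≡1+k+j (+-monoˡ-≤ k (m≤m⊔n (suc j) m₁)))
  m₂≤k₂ : m₂ ≤ suc k + j ∸ k₁
  m₂≤k₂ = m+n≤o⇒m≤o∸n m₂ (subst (_≤ suc k + j) (sym (+-distribˡ-⊔ m₂ (suc j) m₁))
            (⊔-lub (subst (_≤ suc k + j) (sym (+-suc m₂ j)) (s≤s (+-monoˡ-≤ j m₂≤k)))
                   (subst (_≤ suc k + j) (+-comm m₁ m₂) m₁+m₂≤1+k+j)))

SplitBound : (j k : ℕ) → (ℕ → ℕ) → Set
SplitBound j k f = Σ ℕ λ k₁ → Σ ℕ λ k₂ →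
  (suc j ≤ k₁) × (k₁ ≤ k ∸ 1) × (suc j ≤ k₂) × (k₂ ≤ k ∸ 1) × (k₁ + k₂ ≡ k + j) ×
  (f k ≤ 1 + (f k₁ + f k₂))

ErasureSplit-bound : ∀ {n j k} {G : Graph n} (f : ℕ → ℕ) → j + 3 ≤ k → k ≤ n →
  (∀ k′ → suc j ≤ k′ → k′ ≤ k → IsFj n j k′ (f k′)) →
  ∣ support G ∣ ≡ k → edgeCount G ≡ f k → ErasureSplit j G → SplitBound j k f
ErasureSplit-bound {n} {j} {k} {G} f j+3≤k k≤n fs refl eG≡fk split
  with k₁ , k₂ , 1+j≤k₁ , k₁≤k∸1 , 1+j≤k₂ , k₂≤k∸1 , k₁+k₂≡k+j , m₁≤k₁ , m₂≤k₂
         ← split-sizes j+3≤k (ErasureSplit.∣support₁∣< split) (ErasureSplit.∣support₂∣< split)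
                       (ErasureSplit.∣support₁∣+∣support₂∣≤ split) =
  k₁ , k₂ , 1+j≤k₁ , k₁≤k∸1 , 1+j≤k₂ , k₂≤k∸1 , k₁+k₂≡k+j ,
  bound (≤-trans k₁≤k∸1 (m∸n≤m k 1)) (≤-trans k₂≤k∸1 (m∸n≤m k 1)) 1+j≤k₁ 1+j≤k₂ m₁≤k₁ m₂≤k₂
  where
  open ErasureSplit split
  2+j≤n : suc (suc j) ≤ n
  2+j≤n = ≤-trans (subst (suc (suc j) ≤_) (+-comm 3 j) (n≤1+n _)) (≤-trans j+3≤k k≤n)
  bound : ∀ {k₁ k₂} → k₁ ≤ k → k₂ ≤ k → suc j ≤ k₁ → suc j ≤ k₂ →
          ∣ support G₁ ∣ ≤ k₁ → ∣ support G₂ ∣ ≤ k₂ → f k ≤ 1 + (f k₁ + f k₂)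
  bound {k₁} {k₂} k₁≤k k₂≤k 1+j≤k₁ 1+j≤k₂ m₁≤k₁ m₂≤k₂ = begin
    f k                               ≡⟨ eG≡fk ⟨
    edgeCount G                       ≤⟨ edgeCount≤ ⟩
    edgeCount G₁ + edgeCount G₂ + 1   ≤⟨ +-monoˡ-≤ 1 (+-mono-≤ e₁≤ e₂≤) ⟩
    f k₁ + f k₂ + 1                   ≡⟨ +-comm _ 1 ⟩
    1 + (f k₁ + f k₂)                 ∎
    where
    open ≤-Reasoning
    e₁≤ : edgeCount G₁ ≤ f k₁
    e₁≤ = edgeCount≤-of-IsFj (fs k₁ 1+j≤k₁ k₁≤k) 2+j≤n (≤-trans k₁≤k k≤n) G₁-simple G₁-erasable m₁≤k₁
    e₂≤ : edgeCount G₂ ≤ f k₂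
    e₂≤ = edgeCount≤-of-IsFj (fs k₂ 1+j≤k₂ k₂≤k) 2+j≤n (≤-trans k₂≤k k≤n) G₂-simple G₂-erasable m₂≤k₂

SplitBound-of-IsFj : ∀ {n j k} (f : ℕ → ℕ) → j + 3 ≤ k → k ≤ n →
  (∀ k′ → suc j ≤ k′ → k′ ≤ k → IsFj n j k′ (f k′)) → SplitBound j k f
SplitBound-of-IsFj {n} {j} {k} f j+3≤k k≤n fs = from-extremal (proj₁ (fs k 1+j≤k ≤-refl))
  where
  1+j<j+3 : suc j < j + 3
  1+j<j+3 = subst (suc (suc j) ≤_) (+-comm 3 j) (n≤1+n _)
  1+j≤k : suc j ≤ k
  1+j≤k = ≤-trans (<⇒≤ 1+j<j+3) j+3≤k
  from-extremal : (Σ (Graph n) λ G → Admissible n j k G × edgeCount G ≡ f k) → SplitBound j k f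
  from-extremal (G , (G-simple , G-erasable , G-isolated) , eG≡fk) =
    case JErasable-cases G-simple G-erasable of λ where
      (inj₁ G-edgeless) →
        contradiction (trans (sym (∣Empty∣≡0 G-edgeless)) ∣G∣≡k) (<⇒≢ (≤-trans (s≤s z≤n) 1+j≤k))
      (inj₂ (inj₁ n≡1+j)) → contradiction (subst (j + 3 ≤_) n≡1+j (≤-trans j+3≤k k≤n)) (<⇒≱ 1+j<j+3)
      (inj₂ (inj₂ split)) → ErasureSplit-bound f j+3≤k k≤n fs ∣G∣≡k eG≡fk split
    where
    ∣G∣≡k : ∣ support G ∣ ≡ k
    ∣G∣≡k = isolatedCount≡n∸k⇒∣support∣≡k k≤n G-isolated

claim4 : (j n : ℕ) → 2 ≤ j → suc j ≤ n →
    ((∀ k → suc j ≤ k → k ≤ suc (suc j) → k ≤ n → IsFj n j k (k C 2)) ×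
     (∀ k → j + 3 ≤ k → k ≤ n → (f : ℕ → ℕ) →
        (∀ k′ → suc j ≤ k′ → k′ ≤ k → IsFj n j k′ (f k′)) →
        Σ ℕ λ k₁ → Σ ℕ λ k₂ →
          (suc j ≤ k₁) × (k₁ ≤ k ∸ 1) × (suc j ≤ k₂) × (k₂ ≤ k ∸ 1) ×
          (k₁ + k₂ ≡ k + j) ×
          (f k ≤ 1 + (f k₁ + f k₂))))
claim4 j n 2≤j _ =
  (λ k 1+j≤k k≤2+j k≤n → IsFj-C2 (≤-trans 2≤j (≤-trans (n≤1+n j) 1+j≤k)) k≤2+j (≤-trans 1+j≤k k≤n) k≤n) ,
  (λ k j+3≤k k≤n f fs → SplitBound-of-IsFj f j+3≤k k≤n fs)
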